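{- Let $G$ be a finite group, $H$ a connected directed graph with a rotation system, $\psi$ a local $G$-tension on $H$, and $v$ a fixed vertex of $H$. Let $H_\psi$ be the graph defined below, and let $\ell: H_\psi \to H$ be given by $(u,h) \mapsto u$ on vertices and $(e,h) \mapsto e$ on edges. Then $\ell$ is a covering, and $\psi_\ell := \psi \circ \ell$ is a global $G$-tension on $H_\psi$.
   Context: Graphs may have multiple edges and loops. A rotation system assigns to each vertex a cyclic order of its edge-ends (a loop contributes two). Faces are the closed facial walks from face tracing: after traversing an edge into $w$, continue along the next edge-end in the cyclic order at $w$. For a walk $W=(e_1,\dots,e_n)$ and $\psi: E \to G$, the height is $h_\psi(W)=\prod_{i=1}^n \psi(e_i)^{\sigma_W(e_i)}$, with $\sigma_W(e_i)=+1$ if $e_i$ is traversed in its direction and $-1$ otherwise. A local $G$-tension: $h_\psi(W)=1$ for every facial walk $W$; a global $G$-tension: $h_\psi(W)=1$ for every closed walk $W$. The graph $H_\psi$: its vertices are the pairs $(e(W), h_\psi(W))$ where $W$ ranges over walks in $H$ starting at $v$ and $e(W)$ is the end vertex of $W$; for each such vertex $(a,h)$ and each edge $e$ of $H$ directed from $a$ to $b$, $H_\psi$ has an edge $(e,h)$ directed from $(a,h)$ to $(b, h\psi(e))$. (Equivalently, $H_\psi$ is the quotient of the universal covering tree of $H$, whose vertices are the non-backtracking walks from $v$, obtained by identifying vertices $W$ with equal labels $(e(W),h_\psi(W))$ so that the quotient map is locally bijective.) $H_\psi$ carries the rotation system lifted from $H$. A covering $s: K \to H$ is a surjective graph homomorphism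 preserving edge directions that at each vertex $x$ restricts to a bijection from the edge-ends at $x$ to those at $s(x)$ respecting the cyclic orders. -}

module Defs where

open import Level using (0ℓ)
open import Data.Nat using (ℕ; zero; suc; _<_)
open import Data.Fin using (Fin)
open import Data.Product using (Σ; ∃; _×_; _,_; proj₁; proj₂)
open import Data.List using (List; []; _∷_; _++_; [_]; map; upTo)
open import Data.Irrelevant using (Irrelevant) renaming (map to irrMap)
open import Function.Bundles using (_↔_)
open import Relation.Binary.PropositionalEquality
  using (_≡_; _≢_; refl; sym; trans; cong; cong₂; subst)
open import Algebra.Structures using (IsGroup)

record Graph : Set₁ where
  field
    V   : Set
    E   : Set
    src : E → V
    tgt : E → V
open Graph public

FiniteGraph : Graph → Set
FiniteGraph H = (∃ λ n → V H ↔ Fin n) × (∃ λ m → E H ↔ Fin m)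

data Side : Set where
  tl hd : Side

-- an edge-end (e , tl) is the tail end of e (at src e), (e , hd) the head end.
-- An edge-end also denotes a traversal of e starting from that end:
-- (e , tl) traverses e in its direction, (e , hd) against it.
Dart : Graph → Set
Dart H = E H × Side

flipSide : Side → Side
flipSide tl = hd
flipSide hd = tl

flip : {H : Graph} → Dart H → Dart H
flip (e , s) = e , flipSide s

endV : (H : Graph) → Dart H → V H
endV H (e , tl) = src H e
endV H (e , hd) = tgt H e

IsWalk : (H : Graph) → V H → List (Dart H) → V H → Set
IsWalk H u []       w = u ≡ w
IsWalk H u (d ∷ ds) w = (endV H d ≡ u) × IsWalk H (endV H (flip {H} d)) ds w

Connected : Graph → Set
Connected H = ∀ (u w : V H) → ∃ λ ds → IsWalk H u ds w

iter : {A : Set} → (A → A) → ℕ → A → A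
iter f zero    x = x
iter f (suc k) x = f (iter f k x)

-- ρ d is the edge-end following d in the cyclic order at its vertex
record RotationSystem (H : Graph) : Set where
  field
    ρ        : Dart H → Dart H
    ρ-vertex : ∀ d → endV H (ρ d) ≡ endV H d
    ρ⁻¹      : Dart H → Dart H
    ρ-invˡ   : ∀ d → ρ⁻¹ (ρ d) ≡ d
    ρ-invʳ   : ∀ d → ρ (ρ⁻¹ d) ≡ d
    ρ-cyclic : ∀ d d' → endV H d ≡ endV H d' → ∃ λ k → iter ρ k d ≡ d'
open RotationSystem public

-- face tracing: after traversing d, continue along the next edge-end
-- (in the cyclic order) after the end through which we arrived
faceStep : {H : Graph} → RotationSystem H → Dart H → Dart H
faceStep {H} R d = ρ R (flip {H} d)

faceWalk : {H : Graph} → RotationSystem H → Dart H → ℕ → List (Dart H)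
faceWalk R d k = map (λ i → iter (faceStep R) i d) (upTo k)

IsFacePeriod : {H : Graph} → RotationSystem H → Dart H → ℕ → Set
IsFacePeriod R d k =
  (0 < k) × (iter (faceStep R) k d ≡ d) ×
  (∀ j → 0 < j → j < k → iter (faceStep R) j d ≢ d)

record FiniteGroup : Set₁ where
  infixl 7 _∙_
  field
    Carrier : Set
    _∙_     : Carrier → Carrier → Carrier
    ε       : Carrier
    _⁻¹     : Carrier → Carrier
    isGroup : IsGroup _≡_ _∙_ ε _⁻¹
    size    : ℕ
    finite  : Carrier ↔ Fin size
open FiniteGroup public

module _ (G : FiniteGroup) where
  private
    _·_ = _∙_ G
    inv = _⁻¹ G

  val : (H : Graph) → (E H → Carrier G) → Dart H → Carrier G
  val H ψ (e , tl) = ψ e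
  val H ψ (e , hd) = inv (ψ e)

  height : (H : Graph) → (E H → Carrier G) → List (Dart H) → Carrier G
  height H ψ []       = ε G
  height H ψ (d ∷ ds) = val H ψ d · height H ψ ds

  IsLocalTension : (H : Graph) → RotationSystem H → (E H → Carrier G) → Set
  IsLocalTension H R ψ =
    ∀ d k → IsFacePeriod R d k → height H ψ (faceWalk R d k) ≡ ε G

  IsGlobalTension : (H : Graph) → (E H → Carrier G) → Set
  IsGlobalTension H ψ = ∀ u ds → IsWalk H u ds u → height H ψ ds ≡ ε G

dartMap : (K H : Graph) → (E K → E H) → Dart K → Dart H
dartMap K H fE (e , s) = fE e , s

record IsCovering (K : Graph) (ρK : Dart K → Dart K)
                  (H : Graph) (ρH : Dart H → Dart H)
                  (fV : V K → V H) (fE : E K → E H) : Set where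
  field
    hom-src  : ∀ e → src H (fE e) ≡ fV (src K e)
    hom-tgt  : ∀ e → tgt H (fE e) ≡ fV (tgt K e)
    surj-V   : ∀ y → ∃ λ x → fV x ≡ y
    surj-E   : ∀ f → ∃ λ e → fE e ≡ f
    local-inj  : ∀ x d₁ d₂ → endV K d₁ ≡ x → endV K d₂ ≡ x →
                 dartMap K H fE d₁ ≡ dartMap K H fE d₂ → d₁ ≡ d₂
    local-surj : ∀ x d' → endV H d' ≡ fV x →
                 ∃ λ d → (endV K d ≡ x) × (dartMap K H fE d ≡ d')
    rot      : ∀ d → dartMap K H fE (ρK d) ≡ ρH (dartMap K H fE d)

module Lift (G : FiniteGroup) (H : Graph) (R : RotationSystem H)
            (ψ : E H → Carrier G) (v : V H) where
  private
    C = Carrier G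
    _·_ = _∙_ G
    inv = _⁻¹ G
    module GG = IsGroup (isGroup G)

  Reach : V H × C → Set
  Reach (a , h) = ∃ λ ds → IsWalk H v ds a × height G H ψ ds ≡ h

  walk-snoc : ∀ u ds a d → IsWalk H u ds a → endV H d ≡ a →
              IsWalk H u (ds ++ [ d ]) (endV H (flip {H} d))
  walk-snoc u []        a d refl q = q , refl
  walk-snoc u (d' ∷ ds) a d (p , w) q = p , walk-snoc _ ds a d w q

  height-snoc : ∀ ds d → height G H ψ (ds ++ [ d ]) ≡ height G H ψ ds · val G H ψ d
  height-snoc [] d = trans (GG.identityʳ _) (sym (GG.identityˡ _))
  height-snoc (d' ∷ ds) d =
    trans (cong (val G H ψ d' ·_) (height-snoc ds d)) (sym (GG.assoc _ _ _))

  reach-snoc : ∀ {a h} d → Reach (a , h) → endV H d ≡ a →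
               Reach (endV H (flip {H} d) , h · val G H ψ d)
  reach-snoc {a} d (ds , w , eq) q =
    ds ++ [ d ] , walk-snoc v ds a d w q ,
    trans (height-snoc ds d) (cong (_· val G H ψ d) eq)

  Hψ : Graph
  Hψ = record
    { V   = Σ (V H × C) (λ p → Irrelevant (Reach p))
    ; E   = Σ (E H × C) (λ eh → Irrelevant (Reach (src H (proj₁ eh) , proj₂ eh)))
    ; src = λ { ((e , h) , r) → (src H e , h) , r }
    ; tgt = λ { ((e , h) , r) →
                (tgt H e , h · ψ e) , irrMap (λ x → reach-snoc (e , tl) x refl) r }
    }

  ℓV : V Hψ → V H
  ℓV ((a , h) , _) = a

  ℓE : E Hψ → E H
  ℓE ((e , h) , _) = e

  gAt : Dart Hψ → C
  gAt (((e , h) , r) , tl) = h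
  gAt (((e , h) , r) , hd) = h · ψ e

  reachAt : (d : Dart Hψ) →
            Irrelevant (Reach (endV H (dartMap Hψ H ℓE d) , gAt d))
  reachAt (((e , h) , r) , tl) = r
  reachAt (((e , h) , r) , hd) = irrMap (λ x → reach-snoc (e , tl) x refl) r

  liftDart : (g : C) (x : V H) → Irrelevant (Reach (x , g)) →
             (d' : Dart H) → endV H d' ≡ x → Dart Hψ
  liftDart g x r (e , tl) eq =
    ((e , g) , irrMap (subst (λ y → Reach (y , g)) (sym eq)) r) , tl
  liftDart g x r (e , hd) eq =
    ((e , g · inv (ψ e)) , irrMap (λ y → reach-snoc (e , hd) y eq) r) , hd

  ρψ : Dart Hψ → Dart Hψ
  ρψ d = liftDart (gAt d) (endV H (dartMap Hψ H ℓE d)) (reachAt d)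
                  (ρ R (dartMap Hψ H ℓE d)) (ρ-vertex R (dartMap Hψ H ℓE d))

  ψℓ : E Hψ → C
  ψℓ e = ψ (ℓE e)

-- A vertex (a , h) of Hψ remembers the height h of a walk from v to a, and every edge
-- multiplies this label by its ψ-value. Hence the height of any walk in Hψ is the quotient
-- of the labels of its ends, which is trivial for closed walks. ℓ is a covering because
-- the edge-ends at (a , h) are exactly the edge-ends of H at a, each labelled so that it
-- sits at (a , h), and connectivity of H lifts every vertex and edge.
module Submission where

open import Level using (0ℓ)
open import Data.Product using (_×_; _,_; proj₁; proj₂)
open import Data.List using ([]; _∷_)
open import Data.Irrelevant using ([_])
open import Relation.Binary.PropositionalEquality
open import Algebra.Bundles using (Group)
open import Algebra.Structures using (IsGroup)
import Algebra.Properties.Group as GroupProperties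
open import Defs

toGroup : FiniteGroup → Group 0ℓ 0ℓ
toGroup G = record { isGroup = isGroup G }

module _ (G : FiniteGroup) (H : Graph) (R : RotationSystem H)
         (ψ : E H → Carrier G) (v : V H) where
  open Lift G H R ψ v
  open IsGroup (isGroup G) using (assoc; identityʳ)
  open GroupProperties (toGroup G)
    using (∙-cancelʳ; //-rightDividesˡ; //-rightDividesʳ; identityʳ-unique)
  private
    _·_ = _∙_ G

  label : V Hψ → Carrier G
  label ((a , h) , _) = h

  -- r and r' need not agree: the reachability witness is irrelevant.
  Hψ-vertex-≡ : ∀ {a a' h h' r r'} → a ≡ a' → h ≡ h' →
                _≡_ {A = V Hψ} ((a , h) , r) ((a' , h') , r')
  Hψ-vertex-≡ refl refl = refl

  Hψ-dart-≡ : ∀ {e h h' r r'} (s : Side) → h ≡ h' →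
              _≡_ {A = Dart Hψ} (((e , h) , r) , s) (((e , h') , r') , s)
  Hψ-dart-≡ s refl = refl

  label-step : ∀ d → label (endV Hψ (flip {Hψ} d)) ≡ label (endV Hψ d) · val G Hψ ψℓ d
  label-step (((e , h) , r) , tl) = refl
  label-step (((e , h) , r) , hd) = sym (//-rightDividesʳ (ψ e) h)

  label-walk : ∀ u ds w → IsWalk Hψ u ds w → label w ≡ label u · height G Hψ ψℓ ds
  label-walk u []       w refl = sym (identityʳ (label u))
  label-walk u (d ∷ ds) w (refl , walk) = begin
    label w                                             ≡⟨ label-walk _ ds w walk ⟩
    label (endV Hψ (flip {Hψ} d)) · height G Hψ ψℓ ds   ≡⟨ cong (_· _) (label-step d) ⟩
    (label u · val G Hψ ψℓ d) · height G Hψ ψℓ ds       ≡⟨ assoc _ _ _ ⟩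
    label u · height G Hψ ψℓ (d ∷ ds)                   ∎
    where open ≡-Reasoning

  ψℓ-isGlobalTension : IsGlobalTension G Hψ ψℓ
  ψℓ-isGlobalTension u ds walk =
    identityʳ-unique (label u) _ (sym (label-walk u ds u walk))

  ℓ-liftDart : ∀ g x r d' eq → dartMap Hψ H ℓE (liftDart g x r d' eq) ≡ d'
  ℓ-liftDart g x r (e , tl) eq = refl
  ℓ-liftDart g x r (e , hd) eq = refl

  endV-liftDart : ∀ g x r d' eq → endV Hψ (liftDart g x r d' eq) ≡ ((x , g) , r)
  endV-liftDart g x r (e , tl) eq = Hψ-vertex-≡ eq refl
  endV-liftDart g x r (e , hd) eq = Hψ-vertex-≡ eq (//-rightDividesˡ (ψ e) g)

  ℓ-locallyInjective : ∀ x d₁ d₂ → endV Hψ d₁ ≡ x → endV Hψ d₂ ≡ x →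
                       dartMap Hψ H ℓE d₁ ≡ dartMap Hψ H ℓE d₂ → d₁ ≡ d₂
  ℓ-locallyInjective x (((e , h₁) , _) , tl) (((.e , h₂) , _) , .tl) p₁ p₂ refl =
    Hψ-dart-≡ tl (cong label (trans p₁ (sym p₂)))
  ℓ-locallyInjective x (((e , h₁) , _) , hd) (((.e , h₂) , _) , .hd) p₁ p₂ refl =
    Hψ-dart-≡ hd (∙-cancelʳ (ψ e) h₁ h₂ (cong label (trans p₁ (sym p₂))))

  heightFrom-v : Connected H → V H → Carrier G
  heightFrom-v conn y = height G H ψ (proj₁ (conn v y))

  reachFrom-v : (conn : Connected H) (y : V H) → Reach (y , heightFrom-v conn y)
  reachFrom-v conn y = proj₁ (conn v y) , proj₂ (conn v y) , refl

  liftVertex : Connected H → V H → V Hψ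
  liftVertex conn y = (y , heightFrom-v conn y) , [ reachFrom-v conn y ]

  liftEdge : Connected H → E H → E Hψ
  liftEdge conn f = (f , heightFrom-v conn (src H f)) , [ reachFrom-v conn (src H f) ]

  ℓ-isCovering : Connected H → IsCovering Hψ ρψ H (ρ R) ℓV ℓE
  ℓ-isCovering conn = record
    { hom-src    = λ _ → refl
    ; hom-tgt    = λ _ → refl
    ; surj-V     = λ y → liftVertex conn y , refl
    ; surj-E     = λ f → liftEdge conn f , refl
    ; local-inj  = ℓ-locallyInjective
    ; local-surj = λ { ((a , g) , r) d' eq →
        liftDart g a r d' eq , endV-liftDart g a r d' eq , ℓ-liftDart g a r d' eq }
    ; rot        = λ _ → ℓ-liftDart _ _ _ _ _
    }

lemma4p5 : (G : FiniteGroup) (H : Graph) → FiniteGraph H → Connected H →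
           (R : RotationSystem H) (ψ : E H → Carrier G) →
           IsLocalTension G H R ψ → (v : V H) →
           IsCovering (Lift.Hψ G H R ψ v) (Lift.ρψ G H R ψ v) H (ρ R)
                      (Lift.ℓV G H R ψ v) (Lift.ℓE G H R ψ v)
           × IsGlobalTension G (Lift.Hψ G H R ψ v) (Lift.ψℓ G H R ψ v)
lemma4p5 G H _ conn R ψ _ v =
  ℓ-isCovering G H R ψ v conn , ψℓ-isGlobalTension G H R ψ v
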